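{- Let $M$ be an inseparable rank-$4$ matroid that is hypermodular. Then every rank-$3$ flat of $M$ is inseparable.
   Context: A matroid is inseparable (connected) if it has no nontrivial separator; a subset $A\subseteq E(M)$ (e.g. a flat) is inseparable if the restriction $M|_A$ is. A pair of flats $\{A,B\}$ is modular if $r(A\cup B)+r(A\cap B)=r(A)+r(B)$. A rank-$4$ matroid is hypermodular if every pair of two rank-$3$ flats is a modular pair. -}

module Defs where

open import Data.Nat using (ℕ; _+_; _≤_; _<_)
open import Data.Fin using (Fin)
open import Data.Fin.Subset using (Subset; _∪_; _∩_; _─_; _⊆_; _⊂_; _∈_; _∉_; ⁅_⁆; ∣_∣; ⊤; Nonempty)
open import Data.Product using (_×_; Σ)
open import Relation.Nullary using (¬_)

record Matroid (n : ℕ) : Set where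
  field
    r          : Subset n → ℕ
    r-bounded  : ∀ A → r A ≤ ∣ A ∣
    r-mono     : ∀ {A B} → A ⊆ B → r A ≤ r B
    r-submod   : ∀ A B → r (A ∪ B) + r (A ∩ B) ≤ r A + r B

module _ {n : ℕ} (M : Matroid n) where
  open Matroid M

  rank : ℕ
  rank = r ⊤

  IsFlat : Subset n → Set
  IsFlat A = ∀ e → e ∉ A → r A < r (A ∪ ⁅ e ⁆)

  IsSeparatorOf : Subset n → Subset n → Set
  IsSeparatorOf A S = S ⊆ A × r S + r (A ─ S) ≡ r A
    where open import Relation.Binary.PropositionalEquality using (_≡_)

  NontrivialSeparatorOf : Subset n → Subset n → Set
  NontrivialSeparatorOf A S = IsSeparatorOf A S × Nonempty S × S ⊂ A

  InseparableSet : Subset n → Set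
  InseparableSet A = ∀ S → ¬ NontrivialSeparatorOf A S

  Inseparable : Set
  Inseparable = InseparableSet ⊤

  ModularPair : Subset n → Subset n → Set
  ModularPair A B = r (A ∪ B) + r (A ∩ B) ≡ r A + r B
    where open import Relation.Binary.PropositionalEquality using (_≡_)

  Hypermodular : Set
  Hypermodular = rank ≡ 4 × (∀ A B → IsFlat A → r A ≡ 3 → IsFlat B → r B ≡ 3 → ModularPair A B)
    where open import Relation.Binary.PropositionalEquality using (_≡_)

-- Suppose S is a nontrivial separator of M|F.  A connected matroid has no loops, so F splits
-- into a point P and a line Q with r P = 1 and r Q = 2.  By hypermodularity two planes meet in
-- a line, hence every plane contains P or Q; from this, for e ∉ F, every g with
-- r(Q ∪ {e, g}) = 4 lies on the line through P and e.  Because P is not a separator of M such a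
-- g exists, and because Q is not a separator there is f ∉ F off the line through P and e.
-- Then submodularity gives r(Q ∪ {f, g}) = 4, so g also lies on the line through P and f; the
-- two lines share P and g, hence coincide, and f lies on the line through P and e after all.

module Submission where

open import Defs
open import Data.Nat using (ℕ; suc; _+_; _≤_; _<_; z≤n; s≤s; s≤s⁻¹; _≤?_)
open import Data.Nat.Properties
  using (≤-refl; ≤-reflexive; ≤-trans; ≤-antisym; ≤-<-trans; <⇒≱; ≮⇒≥; ≰⇒>; m≤m+n; +-comm; suc-injective; m+1+n≢0;
         +-mono-≤; +-monoˡ-≤; +-monoʳ-≤; +-cancelˡ-≤; +-cancelʳ-≤)
open import Data.Fin using (Fin)
open import Data.Fin.Properties using (any?)
open import Data.Fin.Subset using (Subset; inside; outside; _∪_; _∩_; _─_; _⊆_; _∈_; _∉_; ⁅_⁆; ⊤; ⋃)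
open import Data.Fin.Subset.Properties
  using (_∈?_; ∈⊤; ⊆⊤; ⊆-refl; ⊆-trans; x∈⁅x⁆; x∈⁅y⁆⇒x≡y; x∈p∩q⁺; x∈p∩q⁻; x∈p∪q⁺; x∈p∪q⁻; p⊆p∪q; q⊆p∪q; p∩q⊆p; p∩q⊆q;
         x∈p∧x∉q⇒x∈p─q; p─q⊆p; ∣⁅x⁆∣≡1; ∉⊥)
open import Data.List using ([]; _∷_; map; filter; allFin)
open import Data.List.Membership.Propositional using () renaming (_∈_ to _∈ₗ_)
open import Data.List.Membership.Propositional.Properties using (∈-allFin; ∈-filter⁺)
open import Data.List.Relation.Unary.All using (All; []; _∷_)
open import Data.List.Relation.Unary.All.Properties using (all-filter)
open import Data.List.Relation.Unary.Any using (here; there)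
open import Data.Vec.Base using (_∷_; here; there)
open import Data.Product using (_×_; _,_; proj₁; proj₂; ∃-syntax)
open import Data.Sum using (_⊎_; inj₁; inj₂; [_,_]′; swap)
open import Data.Empty using (⊥)
open import Function using (_∘_)
open import Relation.Nullary using (¬_; Dec; yes; no; contradiction)
open import Relation.Nullary.Decidable using (_×-dec_)
open import Relation.Binary.PropositionalEquality using (_≡_; refl; sym; trans; subst; subst₂; cong₂)

module _ {n : ℕ} where

  ∪-lub : {A B C : Subset n} → A ⊆ C → B ⊆ C → A ∪ B ⊆ C
  ∪-lub {A} {B} A⊆C B⊆C x∈A∪B = [ A⊆C , B⊆C ]′ (x∈p∪q⁻ A B x∈A∪B)

  ∩-glb : {A B C : Subset n} → A ⊆ B → A ⊆ C → A ⊆ B ∩ C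
  ∩-glb A⊆B A⊆C x∈A = x∈p∩q⁺ (A⊆B x∈A , A⊆C x∈A)

  ⊆-∪ˡ : {A B C : Subset n} → A ⊆ B → A ⊆ B ∪ C
  ⊆-∪ˡ {C = C} A⊆B = ⊆-trans A⊆B (p⊆p∪q C)

  ⊆-∪ʳ : {A B C : Subset n} → A ⊆ C → A ⊆ B ∪ C
  ⊆-∪ʳ {B = B} A⊆C = ⊆-trans A⊆C (q⊆p∪q B _)

  ⁅x⁆⊆ : {x : Fin n} {A : Subset n} → x ∈ A → ⁅ x ⁆ ⊆ A
  ⁅x⁆⊆ {x} {A} x∈A y∈⁅x⁆ = subst (_∈ A) (sym (x∈⁅y⁆⇒x≡y x y∈⁅x⁆)) x∈A

  ∈-or-∈─ : ∀ {x : Fin n} {p} q → x ∈ p → x ∈ q ⊎ x ∈ p ─ q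
  ∈-or-∈─ {x} q x∈p with x ∈? q
  ... | yes x∈q = inj₁ x∈q
  ... | no  x∉q = inj₂ (x∈p∧x∉q⇒x∈p─q x∈p x∉q)

  x∈p∪⁅x⁆ : {x : Fin n} {A : Subset n} → x ∈ A ∪ ⁅ x ⁆
  x∈p∪⁅x⁆ {x} = x∈p∪q⁺ (inj₂ (x∈⁅x⁆ x))

x∈p─q⇒x∉q : ∀ {n} {x : Fin n} (p q : Subset n) → x ∈ p ─ q → x ∉ q
x∈p─q⇒x∉q (inside  ∷ p) (inside ∷ q) () here
x∈p─q⇒x∉q (outside ∷ p) (inside ∷ q) () here
x∈p─q⇒x∉q (_ ∷ p) (_ ∷ q) (there x∈p─q) (there x∈q) = x∈p─q⇒x∉q p q x∈p─q x∈q

module MatroidTheory {n : ℕ} (M : Matroid n) where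
  open Matroid M

  infix 4 _∈cl_ _∈cl?_

  _∈cl_ : Fin n → Subset n → Set
  x ∈cl A = r (A ∪ ⁅ x ⁆) ≤ r A

  _∈cl?_ : ∀ x A → Dec (x ∈cl A)
  x ∈cl? A = r (A ∪ ⁅ x ⁆) ≤? r A

  r-⁅⁆≤1 : ∀ x → r ⁅ x ⁆ ≤ 1
  r-⁅⁆≤1 x = subst (r ⁅ x ⁆ ≤_) (∣⁅x⁆∣≡1 x) (r-bounded ⁅ x ⁆)

  r-submod-⊆ : ∀ {X Y U V} → X ⊆ U ∪ V → Y ⊆ U ∩ V → r X + r Y ≤ r U + r V
  r-submod-⊆ {U = U} {V} X⊆U∪V Y⊆U∩V = ≤-trans (+-mono-≤ (r-mono X⊆U∪V) (r-mono Y⊆U∩V)) (r-submod U V)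

  r-∪≤ : ∀ A B → r (A ∪ B) ≤ r A + r B
  r-∪≤ A B = ≤-trans (m≤m+n _ _) (r-submod A B)

  r-∪⁅⁆≤ : ∀ A x → r (A ∪ ⁅ x ⁆) ≤ suc (r A)
  r-∪⁅⁆≤ A x = ≤-trans (r-∪≤ A ⁅ x ⁆) (subst (r A + r ⁅ x ⁆ ≤_) (+-comm (r A) 1) (+-monoʳ-≤ (r A) (r-⁅⁆≤1 x)))

  r-∪⁅⁆∪⁅⁆≤ : ∀ A x y → r ((A ∪ ⁅ x ⁆) ∪ ⁅ y ⁆) ≤ suc (suc (r A))
  r-∪⁅⁆∪⁅⁆≤ A x y = ≤-trans (r-∪⁅⁆≤ (A ∪ ⁅ x ⁆) y) (s≤s (r-∪⁅⁆≤ A x))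

  r≤r+r-─ : ∀ A S → r A ≤ r S + r (A ─ S)
  r≤r+r-─ A S = ≤-trans (r-mono (x∈p∪q⁺ ∘ ∈-or-∈─ S)) (r-∪≤ S (A ─ S))

  ∈⇒∈cl : ∀ {x A} → x ∈ A → x ∈cl A
  ∈⇒∈cl x∈A = r-mono (∪-lub ⊆-refl (⁅x⁆⊆ x∈A))

  r<r-∪⁅⁆⇒∉ : ∀ {x A} → r A < r (A ∪ ⁅ x ⁆) → x ∉ A
  r<r-∪⁅⁆⇒∉ r<r x∈A = <⇒≱ r<r (∈⇒∈cl x∈A)

  ∈cl-mono : ∀ {x A B} → A ⊆ B → x ∈cl A → x ∈cl B
  ∈cl-mono {x} {A} {B} A⊆B x∈clA = +-cancelʳ-≤ (r A) (r (B ∪ ⁅ x ⁆)) (r B)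
    (≤-trans (r-submod-⊆ (∪-lub (⊆-∪ˡ ⊆-refl) (⊆-∪ʳ (⊆-∪ʳ ⊆-refl))) (∩-glb A⊆B (⊆-∪ˡ ⊆-refl)))
             (+-monoʳ-≤ (r B) x∈clA))

  ∈cl-flat⇒∈ : ∀ {x C} → IsFlat M C → x ∈cl C → x ∈ C
  ∈cl-flat⇒∈ {x} {C} C-flat x∈clC with x ∈? C
  ... | yes x∈C = x∈C
  ... | no  x∉C = contradiction x∈clC (<⇒≱ (C-flat x x∉C))

  ∉-flat⇒r< : ∀ {e A C} → IsFlat M C → A ⊆ C → e ∉ C → r A < r (A ∪ ⁅ e ⁆)
  ∉-flat⇒r< C-flat A⊆C e∉C = ≰⇒> λ e∈clA → e∉C (∈cl-flat⇒∈ C-flat (∈cl-mono A⊆C e∈clA))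

  ∈cl-of-full-rank : ∀ {x D X} → D ⊆ X → r X ≤ r D → x ∈ X → x ∈cl D
  ∈cl-of-full-rank D⊆X rX≤rD x∈X = ≤-trans (r-mono (∪-lub D⊆X (⁅x⁆⊆ x∈X))) rX≤rD

  flat-⊇ : ∀ {H X} → IsFlat M H → r X ≤ r (H ∩ X) → X ⊆ H
  flat-⊇ {H} {X} H-flat rX≤ x∈X =
    ∈cl-flat⇒∈ H-flat (∈cl-mono (p∩q⊆p H X) (∈cl-of-full-rank (p∩q⊆q H X) rX≤ x∈X))

  r-∪-⋃⁅⁆≤ : ∀ {A xs} → All (_∈cl A) xs → r (A ∪ ⋃ (map ⁅_⁆ xs)) ≤ r A
  r-∪-⋃⁅⁆≤ [] = r-mono (∪-lub ⊆-refl (λ x∈⊥ → contradiction x∈⊥ ∉⊥))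
  r-∪-⋃⁅⁆≤ {A} {x ∷ xs} (x∈clA ∷ xs∈clA) = ≤-trans (r-mono reorder)
    (≤-trans (∈cl-mono (p⊆p∪q _) x∈clA) (r-∪-⋃⁅⁆≤ xs∈clA))
    where
      U = ⋃ (map ⁅_⁆ xs)
      reorder : A ∪ (⁅ x ⁆ ∪ U) ⊆ (A ∪ U) ∪ ⁅ x ⁆
      reorder = ∪-lub (⊆-∪ˡ (p⊆p∪q U)) (∪-lub (q⊆p∪q _ _) (⊆-∪ˡ (q⊆p∪q A U)))

  ∈-⋃⁅⁆ : ∀ {x : Fin n} {xs} → x ∈ₗ xs → x ∈ ⋃ (map ⁅_⁆ xs)
  ∈-⋃⁅⁆ {x} (here refl) = x∈p∪q⁺ (inj₁ (x∈⁅x⁆ x))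
  ∈-⋃⁅⁆ (there x∈xs)    = x∈p∪q⁺ (inj₂ (∈-⋃⁅⁆ x∈xs))

  -- abstract only for type-checking performance: unfolding the enumeration of Fin n hidden in
  -- closure during later unifications exhausts memory.
  abstract
    closure : Subset n → Subset n
    closure A = ⋃ (map ⁅_⁆ (filter (_∈cl? A) (allFin n)))

    ∈cl⇒∈closure : ∀ {x A} → x ∈cl A → x ∈ closure A
    ∈cl⇒∈closure {x} {A} x∈clA = ∈-⋃⁅⁆ (∈-filter⁺ (_∈cl? A) (∈-allFin x) x∈clA)

    ⊆-closure : ∀ A → A ⊆ closure A
    ⊆-closure A x∈A = ∈cl⇒∈closure (∈⇒∈cl x∈A)

    r-closure : ∀ A → r (closure A) ≡ r A
    r-closure A = ≤-antisym (≤-trans (r-mono (q⊆p∪q A _)) (r-∪-⋃⁅⁆≤ (all-filter (_∈cl? A) (allFin n))))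
                            (r-mono (⊆-closure A))

    closure-flat : ∀ A → IsFlat M (closure A)
    closure-flat A e e∉closure = ≰⇒> λ e∈cl-closure → e∉closure (∈cl⇒∈closure
      (≤-trans (r-mono (∪-lub (⊆-∪ˡ (⊆-closure A)) (q⊆p∪q _ _)))
               (≤-trans e∈cl-closure (≤-reflexive (r-closure A)))))

  r≤-spanned : ∀ {A B} → (∀ {x} → x ∈ B → x ∈cl A) → r B ≤ r A
  r≤-spanned {A} B⊆clA = ≤-trans (r-mono (λ x∈B → ∈cl⇒∈closure (B⊆clA x∈B))) (≤-reflexive (r-closure A))

  augment : ∀ {A B} → r A < r B → ∃[ x ] x ∈ B × r A < r (A ∪ ⁅ x ⁆)
  augment {A} {B} rA<rB with any? (λ x → (x ∈? B) ×-dec (suc (r A) ≤? r (A ∪ ⁅ x ⁆)))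
  ... | yes witness = witness
  ... | no  none    = contradiction (r≤-spanned λ {x} x∈B → ≮⇒≥ λ r< → none (x , x∈B , r<)) (<⇒≱ rA<rB)

module Connected {n : ℕ} (M : Matroid n) (M-inseparable : Inseparable M) where
  open Matroid M
  open MatroidTheory M

  rank<r+r-complement : ∀ {A z w} → z ∈ A → w ∉ A → rank M < r A + r (⊤ ─ A)
  rank<r+r-complement {A} {z} {w} z∈A w∉A = ≰⇒> λ small →
    M-inseparable A ((⊆⊤ , ≤-antisym small (r≤r+r-─ ⊤ A)) , (z , z∈A) , (⊆⊤ , w , ∈⊤ , w∉A))

  loopless : 0 < rank M → ∀ x → r ⁅ x ⁆ ≡ 1
  loopless 0<rank x = ≤-antisym (r-⁅⁆≤1 x) (≮⇒≥ λ x-loop → <⇒≱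
    (rank<r+r-complement (x∈⁅x⁆ x) (r<r-∪⁅⁆⇒∉ (proj₂ (proj₂ (w-spec x-loop)))))
    (+-mono-≤ (s≤s⁻¹ x-loop) (r-mono ⊆⊤)))
    where
      w-spec : r ⁅ x ⁆ < 1 → ∃[ w ] w ∈ ⊤ × r ⁅ x ⁆ < r (⁅ x ⁆ ∪ ⁅ w ⁆)
      w-spec x-loop = augment (≤-<-trans (s≤s⁻¹ x-loop) 0<rank)

module HypermodularRank4 {n : ℕ} (M : Matroid n) (M-hypermodular : Hypermodular M) where
  open Matroid M
  open MatroidTheory M

  IsHyperplane : Subset n → Set
  IsHyperplane H = IsFlat M H × r H ≡ 3

  closure-hyperplane : ∀ {A} → r A ≡ 3 → IsHyperplane (closure A)
  closure-hyperplane {A} rA≡3 = closure-flat A , trans (r-closure A) rA≡3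

  r-∪+r-∩≡6 : ∀ {H K} → IsHyperplane H → IsHyperplane K → r (H ∪ K) + r (H ∩ K) ≡ 6
  r-∪+r-∩≡6 {H} {K} (H-flat , rH≡3) (K-flat , rK≡3) =
    trans (proj₂ M-hypermodular H K H-flat rH≡3 K-flat rK≡3) (cong₂ _+_ rH≡3 rK≡3)

  2≤r-∩ : ∀ {H K} → IsHyperplane H → IsHyperplane K → 2 ≤ r (H ∩ K)
  2≤r-∩ {H} {K} H-hyp K-hyp = +-cancelˡ-≤ 4 2 (r (H ∩ K))
    (subst (_≤ 4 + r (H ∩ K)) (r-∪+r-∩≡6 H-hyp K-hyp) (+-monoˡ-≤ (r (H ∩ K)) r-∪≤4))
    where
      r-∪≤4 : r (H ∪ K) ≤ 4
      r-∪≤4 = ≤-trans (r-mono ⊆⊤) (≤-reflexive (proj₁ M-hypermodular))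

  r-∪≤3 : ∀ {H K Z} → IsHyperplane H → IsHyperplane K → Z ⊆ H ∩ K → 3 ≤ r Z → r (H ∪ K) ≤ 3
  r-∪≤3 {H} {K} H-hyp K-hyp Z⊆H∩K 3≤rZ = +-cancelʳ-≤ 3 (r (H ∪ K)) 3
    (subst (r (H ∪ K) + 3 ≤_) (r-∪+r-∩≡6 H-hyp K-hyp) (+-monoʳ-≤ (r (H ∪ K)) (≤-trans 3≤rZ (r-mono Z⊆H∩K))))

  module Split (loopless : ∀ x → r ⁅ x ⁆ ≡ 1) {F P Q : Subset n} (F-hyperplane : IsHyperplane F)
               (P⊆F : P ⊆ F) (Q⊆F : Q ⊆ F) (F⊆P⊎Q : ∀ {x} → x ∈ F → x ∈ P ⊎ x ∈ Q)
               (rP≡1 : r P ≡ 1) (rQ≡2 : r Q ≡ 2) where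

    F-flat : IsFlat M F
    F-flat = proj₁ F-hyperplane

    ∉P∉Q⇒∉F : ∀ {x} → x ∉ P → x ∉ Q → x ∉ F
    ∉P∉Q⇒∉F x∉P x∉Q x∈F = [ x∉P , x∉Q ]′ (F⊆P⊎Q x∈F)

    outside-F : ∀ {A e k} → A ⊆ F → r A ≡ k → e ∉ F → k < r (A ∪ ⁅ e ⁆)
    outside-F A⊆F rA≡k e∉F = subst (_< _) rA≡k (∉-flat⇒r< F-flat A⊆F e∉F)

    r-P∪⁅⁆≤2 : ∀ x → r (P ∪ ⁅ x ⁆) ≤ 2
    r-P∪⁅⁆≤2 x = subst (λ k → r (P ∪ ⁅ x ⁆) ≤ suc k) rP≡1 (r-∪⁅⁆≤ P x)

    r-Q∪⁅⁆≤3 : ∀ x → r (Q ∪ ⁅ x ⁆) ≤ 3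
    r-Q∪⁅⁆≤3 x = subst (λ k → r (Q ∪ ⁅ x ⁆) ≤ suc k) rQ≡2 (r-∪⁅⁆≤ Q x)

    hyperplane-⊇ : ∀ {H} → IsHyperplane H → P ⊆ H ⊎ Q ⊆ H
    hyperplane-⊇ {H} (H-flat , rH≡3) with 1 ≤? r (H ∩ P) | 2 ≤? r (H ∩ Q)
    ... | yes P-meets  | _           = inj₁ (flat-⊇ H-flat (subst (_≤ r (H ∩ P)) (sym rP≡1) P-meets))
    ... | no  _        | yes Q-meets = inj₂ (flat-⊇ H-flat (subst (_≤ r (H ∩ Q)) (sym rQ≡2) Q-meets))
    ... | no  P-misses | no Q-misses = contradiction r-∩≤1 (<⇒≱ (2≤r-∩ (H-flat , rH≡3) F-hyperplane))
      where
        H∩F⊆ : H ∩ F ⊆ (H ∩ P) ∪ (H ∩ Q)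
        H∩F⊆ {x} x∈H∩F with x∈p∩q⁻ H F x∈H∩F
        ... | x∈H , x∈F = x∈p∪q⁺ ([ (λ x∈P → inj₁ (x∈p∩q⁺ (x∈H , x∈P))) , (λ x∈Q → inj₂ (x∈p∩q⁺ (x∈H , x∈Q))) ]′ (F⊆P⊎Q x∈F))
        r-∩≤1 : r (H ∩ F) ≤ 1
        r-∩≤1 = ≤-trans (r-mono H∩F⊆)
                 (≤-trans (r-∪≤ (H ∩ P) (H ∩ Q)) (+-mono-≤ (s≤s⁻¹ (≰⇒> P-misses)) (s≤s⁻¹ (≰⇒> Q-misses))))

    -- If P, e, g spanned a plane H, pick t ∈ H ∩ Q and t′ ∉ H.  The plane K spanned by t′, e, g
    -- contains P or Q, so H ∩ K contains the plane P e g or t e g, while H ∪ K has rank 4: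
    -- this contradicts the modularity of {H , K}.
    module NoPlaneThroughP {e g : Fin n} (e∉F : e ∉ F) (Qeg-spanning : 4 ≤ r ((Q ∪ ⁅ e ⁆) ∪ ⁅ g ⁆))
                           (Peg-plane : 3 ≤ r ((P ∪ ⁅ e ⁆) ∪ ⁅ g ⁆)) where
      private
        g∉cl : ∀ {A} → A ⊆ Q ∪ ⁅ e ⁆ → ¬ g ∈cl A
        g∉cl A⊆Q∪e g∈clA = <⇒≱ Qeg-spanning (≤-trans (∈cl-mono A⊆Q∪e g∈clA) (r-Q∪⁅⁆≤3 e))

        I : Subset n
        I = (P ∪ ⁅ e ⁆) ∪ ⁅ g ⁆

        H : Subset n
        H = closure I

        H-hyp : IsHyperplane H
        H-hyp = closure-hyperplane (≤-antisym (subst (λ k → r I ≤ suc (suc k)) rP≡1 (r-∪⁅⁆∪⁅⁆≤ P e g)) Peg-plane)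

        I⊆H : I ⊆ H
        I⊆H = ⊆-closure I

        e∈H : e ∈ H
        e∈H = I⊆H (x∈p∪q⁺ (inj₁ x∈p∪⁅x⁆))

        g∈H : g ∈ H
        g∈H = I⊆H x∈p∪⁅x⁆

        t-spec : ∃[ t ] t ∈ H ∩ F × r P < r (P ∪ ⁅ t ⁆)
        t-spec = augment (subst (_< r (H ∩ F)) (sym rP≡1) (2≤r-∩ H-hyp F-hyperplane))

        t : Fin n
        t = proj₁ t-spec

        t∈H : t ∈ H
        t∈H = proj₁ (x∈p∩q⁻ H F (proj₁ (proj₂ t-spec)))

        t∈F : t ∈ F
        t∈F = proj₂ (x∈p∩q⁻ H F (proj₁ (proj₂ t-spec)))

        t∈Q : t ∈ Q
        t∈Q = [ (λ t∈P → contradiction t∈P (r<r-∪⁅⁆⇒∉ (proj₂ (proj₂ t-spec)))) , (λ t∈Q → t∈Q) ]′ (F⊆P⊎Q t∈F)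

        t′-spec : ∃[ t′ ] t′ ∈ ⊤ × r H < r (H ∪ ⁅ t′ ⁆)
        t′-spec = augment (subst₂ _<_ (sym (proj₂ H-hyp)) (sym (proj₁ M-hypermodular)) ≤-refl)

        t′ : Fin n
        t′ = proj₁ t′-spec

        H∪t′-spanning : 3 < r (H ∪ ⁅ t′ ⁆)
        H∪t′-spanning = subst (_< r (H ∪ ⁅ t′ ⁆)) (proj₂ H-hyp) (proj₂ (proj₂ t′-spec))

        eg-line : 2 ≤ r (⁅ e ⁆ ∪ ⁅ g ⁆)
        eg-line = ≮⇒≥ λ eg-point → g∉cl (q⊆p∪q Q _) (≤-trans (s≤s⁻¹ eg-point) (≤-reflexive (sym (loopless e))))

        K₀ : Subset n
        K₀ = (⁅ t′ ⁆ ∪ ⁅ e ⁆) ∪ ⁅ g ⁆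

        K₀-plane : r K₀ ≡ 3
        K₀-plane = ≤-antisym (≤-trans (r-∪⁅⁆∪⁅⁆≤ ⁅ t′ ⁆ e g) (s≤s (s≤s (r-⁅⁆≤1 t′))))
          (≮⇒≥ λ K₀-line → r<r-∪⁅⁆⇒∉ (proj₂ (proj₂ t′-spec))
            (∈cl-flat⇒∈ (proj₁ H-hyp) (∈cl-mono eg⊆H (≤-trans (r-mono eg∪t′⊆K₀) (≤-trans (s≤s⁻¹ K₀-line) eg-line)))))
          where
            eg⊆H : ⁅ e ⁆ ∪ ⁅ g ⁆ ⊆ H
            eg⊆H = ∪-lub (⁅x⁆⊆ e∈H) (⁅x⁆⊆ g∈H)
            eg∪t′⊆K₀ : (⁅ e ⁆ ∪ ⁅ g ⁆) ∪ ⁅ t′ ⁆ ⊆ K₀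
            eg∪t′⊆K₀ = ∪-lub (∪-lub (⊆-∪ˡ (q⊆p∪q _ _)) (q⊆p∪q _ _)) (⊆-∪ˡ (p⊆p∪q _))

        K : Subset n
        K = closure K₀

        K-hyp : IsHyperplane K
        K-hyp = closure-hyperplane K₀-plane

        e∈K : e ∈ K
        e∈K = ⊆-closure K₀ (x∈p∪q⁺ (inj₁ x∈p∪⁅x⁆))

        g∈K : g ∈ K
        g∈K = ⊆-closure K₀ x∈p∪⁅x⁆

        t′∈K : t′ ∈ K
        t′∈K = ⊆-closure K₀ (x∈p∪q⁺ (inj₁ (x∈p∪q⁺ (inj₁ (x∈⁅x⁆ t′)))))

        no-plane-in-H∩K : ∀ {Z} → Z ⊆ H ∩ K → 3 ≤ r Z → ⊥
        no-plane-in-H∩K Z⊆H∩K 3≤rZ = <⇒≱ H∪t′-spanning (≤-trans (r-mono H∪t′⊆H∪K) (r-∪≤3 H-hyp K-hyp Z⊆H∩K 3≤rZ))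
          where
            H∪t′⊆H∪K : H ∪ ⁅ t′ ⁆ ⊆ H ∪ K
            H∪t′⊆H∪K = ∪-lub (p⊆p∪q K) (⊆-∪ʳ (⁅x⁆⊆ t′∈K))

        teg-plane : 3 ≤ r ((⁅ t ⁆ ∪ ⁅ e ⁆) ∪ ⁅ g ⁆)
        teg-plane = ≮⇒≥ λ teg-line → g∉cl (∪-lub (⊆-∪ˡ (⁅x⁆⊆ t∈Q)) (q⊆p∪q Q _)) (≤-trans (s≤s⁻¹ teg-line) te-line)
          where
            te-line : 2 ≤ r (⁅ t ⁆ ∪ ⁅ e ⁆)
            te-line = outside-F (⁅x⁆⊆ t∈F) (loopless t) e∉F

      absurd : ⊥
      absurd with hyperplane-⊇ K-hyp
      ... | inj₁ P⊆K = no-plane-in-H∩K (∩-glb I⊆H (∪-lub (∪-lub P⊆K (⁅x⁆⊆ e∈K)) (⁅x⁆⊆ g∈K))) Peg-plane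
      ... | inj₂ Q⊆K = no-plane-in-H∩K (∩-glb (∪-lub (∪-lub (⁅x⁆⊆ t∈H) (⁅x⁆⊆ e∈H)) (⁅x⁆⊆ g∈H))
                                              (∪-lub (∪-lub (⁅x⁆⊆ (Q⊆K t∈Q)) (⁅x⁆⊆ e∈K)) (⁅x⁆⊆ g∈K)))
                                       teg-plane

    line-through-P : ∀ {e g} → e ∉ F → 4 ≤ r ((Q ∪ ⁅ e ⁆) ∪ ⁅ g ⁆) → r ((P ∪ ⁅ e ⁆) ∪ ⁅ g ⁆) ≤ 2
    line-through-P e∉F Qeg-spanning = ≮⇒≥ (NoPlaneThroughP.absurd e∉F Qeg-spanning)

    Q-spanning-transfer : ∀ {e f g} → f ∉ F → 4 ≤ r ((Q ∪ ⁅ e ⁆) ∪ ⁅ g ⁆) → r ((Q ∪ ⁅ e ⁆) ∪ ⁅ f ⁆) ≤ 3 →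
                          4 ≤ r ((Q ∪ ⁅ f ⁆) ∪ ⁅ g ⁆)
    Q-spanning-transfer {e} {f} {g} f∉F Qeg-spanning Qef≤3 = +-cancelˡ-≤ 3 4 _
      (≤-trans (+-mono-≤ Qeg-spanning (outside-F Q⊆F rQ≡2 f∉F))
               (≤-trans (r-submod-⊆ Qeg⊆Qef∪Qfg Qf⊆Qef∩Qfg) (+-monoˡ-≤ _ Qef≤3)))
      where
        Qeg⊆Qef∪Qfg : (Q ∪ ⁅ e ⁆) ∪ ⁅ g ⁆ ⊆ ((Q ∪ ⁅ e ⁆) ∪ ⁅ f ⁆) ∪ ((Q ∪ ⁅ f ⁆) ∪ ⁅ g ⁆)
        Qeg⊆Qef∪Qfg = ∪-lub (⊆-∪ˡ (p⊆p∪q _)) (⊆-∪ʳ (q⊆p∪q _ _))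
        Qf⊆Qef∩Qfg : Q ∪ ⁅ f ⁆ ⊆ ((Q ∪ ⁅ e ⁆) ∪ ⁅ f ⁆) ∩ ((Q ∪ ⁅ f ⁆) ∪ ⁅ g ⁆)
        Qf⊆Qef∩Qfg = ∩-glb (∪-lub (⊆-∪ˡ (p⊆p∪q _)) (q⊆p∪q _ _)) (p⊆p∪q _)

    line-through-P-trans : ∀ {e f g} → g ∉ F → r ((P ∪ ⁅ e ⁆) ∪ ⁅ g ⁆) ≤ 2 → r ((P ∪ ⁅ f ⁆) ∪ ⁅ g ⁆) ≤ 2 →
                           r ((P ∪ ⁅ e ⁆) ∪ ⁅ f ⁆) ≤ 2
    line-through-P-trans {e} {f} {g} g∉F Peg-line Pfg-line = +-cancelʳ-≤ 2 _ 2
      (≤-trans (+-monoʳ-≤ _ (outside-F P⊆F rP≡1 g∉F))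
               (≤-trans (r-submod-⊆ Pef⊆Peg∪Pfg Pg⊆Peg∩Pfg) (+-mono-≤ Peg-line Pfg-line)))
      where
        Pef⊆Peg∪Pfg : (P ∪ ⁅ e ⁆) ∪ ⁅ f ⁆ ⊆ ((P ∪ ⁅ e ⁆) ∪ ⁅ g ⁆) ∪ ((P ∪ ⁅ f ⁆) ∪ ⁅ g ⁆)
        Pef⊆Peg∪Pfg = ∪-lub (⊆-∪ˡ (p⊆p∪q _)) (⊆-∪ʳ (⊆-∪ˡ (q⊆p∪q _ _)))
        Pg⊆Peg∩Pfg : P ∪ ⁅ g ⁆ ⊆ ((P ∪ ⁅ e ⁆) ∪ ⁅ g ⁆) ∩ ((P ∪ ⁅ f ⁆) ∪ ⁅ g ⁆)
        Pg⊆Peg∩Pfg = ∩-glb (∪-lub (⊆-∪ˡ (p⊆p∪q _)) (q⊆p∪q _ _)) (∪-lub (⊆-∪ˡ (p⊆p∪q _)) (q⊆p∪q _ _))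

    no-split : 4 ≤ r (⊤ ─ P) → 3 ≤ r (⊤ ─ Q) → ⊥
    no-split P-co Q-co = <⇒≱ Pef-plane
      (line-through-P-trans g∉F (line-through-P e∉F Qeg-spanning) (line-through-P f∉F Qfg-spanning))
      where
        e-spec : ∃[ e ] e ∈ ⊤ × r F < r (F ∪ ⁅ e ⁆)
        e-spec = augment (subst₂ _<_ (sym (proj₂ F-hyperplane)) (sym (proj₁ M-hypermodular)) ≤-refl)
        e : Fin n
        e = proj₁ e-spec
        e∉F : e ∉ F
        e∉F = r<r-∪⁅⁆⇒∉ (proj₂ (proj₂ e-spec))

        g-spec : ∃[ g ] g ∈ ⊤ ─ P × r (Q ∪ ⁅ e ⁆) < r ((Q ∪ ⁅ e ⁆) ∪ ⁅ g ⁆)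
        g-spec = augment (≤-<-trans (r-Q∪⁅⁆≤3 e) P-co)
        g : Fin n
        g = proj₁ g-spec
        Qeg-spanning : 4 ≤ r ((Q ∪ ⁅ e ⁆) ∪ ⁅ g ⁆)
        Qeg-spanning = ≤-<-trans (outside-F Q⊆F rQ≡2 e∉F) (proj₂ (proj₂ g-spec))
        g∉F : g ∉ F
        g∉F = ∉P∉Q⇒∉F (x∈p─q⇒x∉q ⊤ P (proj₁ (proj₂ g-spec)))
                      (λ g∈Q → r<r-∪⁅⁆⇒∉ (proj₂ (proj₂ g-spec)) (x∈p∪q⁺ (inj₁ g∈Q)))

        f-spec : ∃[ f ] f ∈ ⊤ ─ Q × r (P ∪ ⁅ e ⁆) < r ((P ∪ ⁅ e ⁆) ∪ ⁅ f ⁆)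
        f-spec = augment (≤-<-trans (r-P∪⁅⁆≤2 e) Q-co)
        f : Fin n
        f = proj₁ f-spec
        Pef-plane : 3 ≤ r ((P ∪ ⁅ e ⁆) ∪ ⁅ f ⁆)
        Pef-plane = ≤-<-trans (outside-F P⊆F rP≡1 e∉F) (proj₂ (proj₂ f-spec))
        f∉F : f ∉ F
        f∉F = ∉P∉Q⇒∉F (λ f∈P → r<r-∪⁅⁆⇒∉ (proj₂ (proj₂ f-spec)) (x∈p∪q⁺ (inj₁ f∈P)))
                      (x∈p─q⇒x∉q ⊤ Q (proj₁ (proj₂ f-spec)))

        Qfg-spanning : 4 ≤ r ((Q ∪ ⁅ f ⁆) ∪ ⁅ g ⁆)
        Qfg-spanning = Q-spanning-transfer f∉F Qeg-spanning
          (≮⇒≥ λ Qef-spanning → <⇒≱ Pef-plane (line-through-P e∉F Qef-spanning))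

module ConnectedHypermodular {n : ℕ} (M : Matroid n) (M-inseparable : Inseparable M)
                            (M-hypermodular : Hypermodular M) where
  open Matroid M
  open MatroidTheory M
  open Connected M M-inseparable
  open HypermodularRank4 M M-hypermodular

  rank≡4 : rank M ≡ 4
  rank≡4 = proj₁ M-hypermodular

  loopless-rank4 : ∀ z → r ⁅ z ⁆ ≡ 1
  loopless-rank4 = loopless (subst (0 <_) (sym rank≡4) (s≤s z≤n))

  1≤r-of-∈ : ∀ {z A} → z ∈ A → 1 ≤ r A
  1≤r-of-∈ {z} z∈A = ≤-trans (≤-reflexive (sym (loopless-rank4 z))) (r-mono (⁅x⁆⊆ z∈A))

  4<k+r-complement : ∀ {A z w k} → z ∈ A → w ∉ A → r A ≡ k → 4 < k + r (⊤ ─ A)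
  4<k+r-complement {A} z∈A w∉A refl = subst (_< r A + r (⊤ ─ A)) rank≡4 (rank<r+r-complement z∈A w∉A)

  no-point-line-split : ∀ {F P Q p q} → IsHyperplane F → P ⊆ F → Q ⊆ F → (∀ {z} → z ∈ F → z ∈ P ⊎ z ∈ Q) →
                        p ∈ P → q ∉ P → q ∈ Q → p ∉ Q → r P ≡ 1 → r Q ≡ 2 → ⊥
  no-point-line-split {P = P} {Q} F-hyp P⊆F Q⊆F F⊆P⊎Q p∈P q∉P q∈Q p∉Q rP≡1 rQ≡2 =
    Split.no-split loopless-rank4 {P = P} {Q = Q} F-hyp P⊆F Q⊆F F⊆P⊎Q rP≡1 rQ≡2
      (s≤s⁻¹ (4<k+r-complement p∈P q∉P rP≡1)) (s≤s⁻¹ (s≤s⁻¹ (4<k+r-complement q∈Q p∉Q rQ≡2)))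

1+2-or-2+1 : ∀ {a b} → 1 ≤ a → 1 ≤ b → a + b ≡ 3 → (a ≡ 1 × b ≡ 2) ⊎ (a ≡ 2 × b ≡ 1)
1+2-or-2+1 {1}                 _ _ refl = inj₁ (refl , refl)
1+2-or-2+1 {2}                 _ _ refl = inj₂ (refl , refl)
1+2-or-2+1 {suc (suc (suc a))} {suc b} _ _ eq = contradiction (suc-injective (suc-injective (suc-injective eq))) (m+1+n≢0 a)

proposition3p6 : {n : ℕ} (M : Matroid n) → rank M ≡ 4 → Inseparable M → Hypermodular M →
    (F : Subset n) → IsFlat M F → Matroid.r M F ≡ 3 → InseparableSet M F
proposition3p6 M _ M-inseparable M-hypermodular F F-flat rF≡3 S ((S⊆F , rS+rT≡rF) , (x , x∈S) , (_ , y , y∈F , y∉S)) =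
  [ (λ (rS≡1 , rT≡2) → no-point-line-split F-hyp S⊆F T⊆F (∈-or-∈─ S) x∈S y∉S y∈T x∉T rS≡1 rT≡2)
  , (λ (rS≡2 , rT≡1) → no-point-line-split F-hyp T⊆F S⊆F (swap ∘ ∈-or-∈─ S) y∈T x∉T x∈S y∉S rT≡1 rS≡2)
  ]′ (1+2-or-2+1 (1≤r-of-∈ x∈S) (1≤r-of-∈ y∈T) (trans rS+rT≡rF rF≡3))
  where
    open HypermodularRank4 M M-hypermodular using (IsHyperplane)
    open ConnectedHypermodular M M-inseparable M-hypermodular

    F-hyp : IsHyperplane F
    F-hyp = F-flat , rF≡3
    T : Subset _
    T = F ─ S
    T⊆F : T ⊆ F
    T⊆F = p─q⊆p F S
    y∈T : y ∈ T
    y∈T = x∈p∧x∉q⇒x∈p─q y∈F y∉S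
    x∉T : x ∉ T
    x∉T x∈T = x∈p─q⇒x∉q F S x∈T x∈S
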